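{- Let $n\ge 4$ and let $\varphi(\vec{x},\vec{y})$ be a prime generalized $P$-encoding on $n$ input variables whose number of clauses $|\varphi|$ is minimum among all generalized $P$-encodings on $n$ input variables. Then either there is a generalized $P$-encoding $\varphi'$ on $n$ input variables in regular form with $|\varphi'|=|\varphi|$, or there is a generalized $P$-encoding $\varphi'$ on $n-1$ input variables with $|\varphi|\ge|\varphi'|+3$.
   Context: A CNF formula is a set of clauses (sets of literals); $|\varphi|$ is its number of clauses. Let $\vec{x}=(x_1,\dots,x_n)$ be input variables and $\vec{y}$ a finite set of auxiliary variables. A CNF $\varphi(\vec{x},\vec{y})$ is a generalized $P$-encoding on $n$ input variables if (a) $\varphi\wedge x_i$ is satisfiable for each $i\in[n]$, and (b) $\varphi\models\overline{x_i}\vee\overline{x_j}$ for all distinct $i,j\in[n]$. It is prime if every CNF obtained from $\varphi$ by removing one literal from one clause is not a generalized $P$-encoding on $n$ input variables. Let $Q_{\varphi,i}$ be the set of clauses of $\varphi$ containing the literal $\overline{x_i}$. $\varphi$ is in regular form if for each $i\in[n]$: $|Q_{\varphi,i}|=2$, $x_i$ is the only input variable occurring in the clauses of $Q_{\varphi,i}$, and each clause of $Q_{\varphi,i}$ has exactly two literals. -}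

module Defs where

open import Data.Nat using (ℕ; zero; suc; _+_)
open import Data.Bool using (Bool; true; false)
open import Data.Bool.Properties using () renaming (_≟_ to _≟B_)
open import Data.Fin using (Fin; _↑ˡ_)
open import Data.Vec using (Vec; []; _∷_; lookup; _[_]≔_)
open import Data.List using (List; length; filter; updateAt)
open import Data.List.Relation.Unary.All using (All)
open import Data.List.Relation.Unary.Unique.Propositional using (Unique)
open import Data.Product using (_×_; _,_; Σ; ∃; proj₁; proj₂)
open import Data.Sum using (_⊎_)
open import Relation.Nullary using (¬_)
open import Relation.Binary.PropositionalEquality using (_≡_; _≢_)

-- A clause over k variables is a SET of literals, represented by two
-- characteristic vectors: positive occurrences and negative occurrences.
Clause : ℕ → Set
Clause k = Vec Bool k × Vec Bool k

pos neg : ∀ {k} → Clause k → Vec Bool k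
pos = proj₁
neg = proj₂

ones : ∀ {k} → Vec Bool k → ℕ
ones [] = 0
ones (true ∷ v) = suc (ones v)
ones (false ∷ v) = ones v

clauseSize : ∀ {k} → Clause k → ℕ
clauseSize C = ones (pos C) + ones (neg C)

Assignment : ℕ → Set
Assignment k = Fin k → Bool

satClause : ∀ {k} → Assignment k → Clause k → Set
satClause {k} α C =
  ∃ λ (v : Fin k) → (lookup (pos C) v ≡ true × α v ≡ true)
                  ⊎ (lookup (neg C) v ≡ true × α v ≡ false)

sat : ∀ {k} → Assignment k → List (Clause k) → Set
sat α cs = All (satClause α) cs

-- variables: n input variables x_1..x_n followed by m auxiliary variables
inp : ∀ {n} m → Fin n → Fin (n + m)
inp m i = i ↑ˡ m

-- generalized P-encoding property (semantic; insensitive to duplicate clauses)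
IsGPE : (n m : ℕ) → List (Clause (n + m)) → Set
IsGPE n m cs =
  (∀ (i : Fin n) → ∃ λ (α : Assignment (n + m)) → sat α cs × α (inp m i) ≡ true)
  × (∀ (i j : Fin n) → i ≢ j → ∀ (α : Assignment (n + m)) → sat α cs →
       α (inp m i) ≡ false ⊎ α (inp m j) ≡ false)

record CNF (n : ℕ) : Set where
  field
    m        : ℕ
    clauses  : List (Clause (n + m))
    distinct : Unique clauses
open CNF public

size : ∀ {n} → CNF n → ℕ
size φ = length (clauses φ)

GPE : ∀ {n} → CNF n → Set
GPE {n} φ = IsGPE n (m φ) (clauses φ)

removeLit : ∀ {k} → Fin k → Bool → Clause k → Clause k
removeLit v true  (p , q) = (p [ v ]≔ false , q)
removeLit v false (p , q) = (p , q [ v ]≔ false)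

litIn : ∀ {k} → Fin k → Bool → Clause k → Bool
litIn v true  C = lookup (pos C) v
litIn v false C = lookup (neg C) v

Prime : ∀ {n} → CNF n → Set
Prime {n} φ =
  ∀ (c : Fin (length (clauses φ))) (v : Fin (n + m φ)) (b : Bool) →
    litIn v b (Data.List.lookup (clauses φ) c) ≡ true →
    ¬ IsGPE n (m φ) (updateAt (clauses φ) c (removeLit v b))

Q : ∀ {n} (φ : CNF n) → Fin n → List (Clause (n + m φ))
Q φ i = filter (λ C → lookup (neg C) (inp (m φ) i) ≟B true) (clauses φ)

RegularForm : ∀ {n} → CNF n → Set
RegularForm {n} φ =
  ∀ (i : Fin n) →
    length (Q φ i) ≡ 2
    × All (λ C → clauseSize C ≡ 2
                 × (∀ (j : Fin n) → j ≢ i →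
                      lookup (pos C) (inp (m φ) j) ≡ false
                      × lookup (neg C) (inp (m φ) j) ≡ false))
          (Q φ i)

{-# OPTIONS --safe #-}
module Submission where

-- Let α_l denote a model of φ with x_l true. Primality forces every clause of Q_i to be
-- ¬x_i ∨ ℓ for a single partner literal ℓ, true in α_i; so ℓ is x_i, some ¬x_j, or auxiliary.
-- Setting x_j true in α_l (l ≠ j) would violate the at-most-one condition, so some clause of
-- Q_j must break, which is impossible if its partner is x_j or ¬x_k with k ≠ l. With n ≥ 4 such
-- an l exists whenever |Q_j| ≤ 2 and no partner in Q_j is auxiliary; in particular Q_j ≠ ∅.
-- If Q_i = {¬x_i ∨ y^b} with y auxiliary, y^b agrees with x_i in all models, and substituting
-- x_i for it removes a clause, contradicting minimality. If some |Q_i| ≥ 3, setting x_i to false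
-- leaves an encoding on n - 1 inputs with at least three clauses fewer. Otherwise all |Q_i| = 2,
-- and φ is regular unless some Q_i contains ¬x_i ∨ ¬x_j; then Q_j = {¬x_i ∨ ¬x_j, ¬x_j ∨ y^b}
-- with y auxiliary, and setting x_i to false (two clauses) and substituting x_j for y^b (one
-- more clause) again saves three clauses.

open import Defs

open import Level using (0ℓ)
open import Function using (_∘_; const; case_of_)
open import Function.Definitions using (Injective)
open import Data.Empty using (⊥; ⊥-elim)
open import Data.Product using (_×_; Σ; ∃; _,_; proj₁; proj₂; map₁)
open import Data.Product.Properties using () renaming (≡-dec to ×-≡-dec)
open import Data.Sum using (_⊎_; inj₁; inj₂; [_,_]′) renaming (map to ⊎-map; swap to ⊎-swap)
import Data.Sum.Effectful.Left as SumLeft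
open import Data.Bool using (Bool; true; false; not; _xor_)
open import Data.Bool.Properties
  using (¬-not; not-¬; not-involutive; xor-identityʳ) renaming (_≟_ to _≟B_)
open import Data.Nat using (ℕ; zero; suc; z≤n; s≤s; _≤_; _<_; _+_; _∸_)
open import Data.Nat.Properties
  using (+-suc; ≤-trans; ≤-reflexive; ≤-<-trans; <-irrefl; +-mono-≤; +-monoˡ-≤; module ≤-Reasoning)
open import Data.Fin using (Fin; _↑ˡ_; punchIn; punchOut; fromℕ; inject₁; cast; toℕ)
open import Data.Fin.Patterns using (0F; 1F; 2F)
open import Data.Fin.Properties
  using (↑ˡ-injective; punchIn-injective; punchInᵢ≢i; punchIn-punchOut; any?; pigeonhole; ¬∀⟶∃¬;
         toℕ-injective; toℕ-cast; toℕ-↑ˡ; toℕ-inject₁; <⇒≢; sequence)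
  renaming (_≟_ to _≟F_)
open import Data.Fin.Permutation as Perm using (Permutation; _⟨$⟩ʳ_; _⟨$⟩ˡ_; inverseˡ; _∘ₚ_)
open import Data.Vec as Vec using (Vec; tabulate; lookup; _[_]≔_)
open import Data.Vec.Properties using (lookup∘tabulate; lookup∘update; lookup∘update′; ≡-dec)
import Data.Vec.Functional as VecF
open import Data.Vec.Functional.Properties using (updateAt-updates; updateAt-minimal)
open import Data.List as List using (List; []; _∷_; length; filter; map; deduplicate)
open import Data.List.Properties using (length-map; length-deduplicate; filter-notAll)
open import Data.List.Relation.Unary.All as All using (All; []; _∷_)
open import Data.List.Relation.Unary.All.Properties using (map⁺; map⁻; deduplicate⁺; deduplicate⁻)
open import Data.List.Relation.Unary.Any as Any using (here; there; index)
open import Data.List.Relation.Unary.Any.Properties using (lookup-index)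
open import Data.List.Relation.Unary.Unique.DecPropositional.Properties using (deduplicate-!)
open import Data.List.Membership.Propositional using (_∈_)
open import Data.List.Membership.Propositional.Properties
  using (∈-filter⁺; ∈-filter⁻; ∈-map⁺; ∈-map⁻)
open import Relation.Nullary using (¬_; Dec; yes; no; ¬?; does; contradiction)
open import Relation.Nullary.Decidable using (_⊎-dec_; _×-dec_; map′; dec-true)
open import Relation.Binary.Definitions using (DecidableEquality)
open import Relation.Binary.PropositionalEquality
  using (_≡_; _≢_; refl; sym; trans; cong; cong₂; subst; module ≡-Reasoning)

private
  variable
    k k′ n : ℕ
    α β : Assignment k
    C : Clause k
    cs : List (Clause k)

-- Literals and clauses

Lit : ℕ → Set
Lit k = Fin k × Bool

infix 4 _∈ᶜ_ _∈ᶜ?_ _⊨_ _≟ˡ_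

-- A wrapper rather than a synonym for litIn v b C ≡ true, so that ℓ and C can be inferred.
record _∈ᶜ_ (ℓ : Lit k) (C : Clause k) : Set where
  constructor occurs
  field litIn≡true : litIn (proj₁ ℓ) (proj₂ ℓ) C ≡ true
open _∈ᶜ_

_∈ᶜ?_ : (ℓ : Lit k) (C : Clause k) → Dec (ℓ ∈ᶜ C)
(v , b) ∈ᶜ? C = map′ occurs litIn≡true (litIn v b C ≟B true)

_⊨_ : Assignment k → Lit k → Set
α ⊨ (v , b) = α v ≡ b

_≟ˡ_ : DecidableEquality (Lit k)
_≟ˡ_ = ×-≡-dec _≟F_ _≟B_

lit⇒satClause : ∀ {ℓ} → ℓ ∈ᶜ C → α ⊨ ℓ → satClause α C
lit⇒satClause {ℓ = v , true}  (occurs ℓ∈C) α⊨ℓ = v , inj₁ (ℓ∈C , α⊨ℓ)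
lit⇒satClause {ℓ = v , false} (occurs ℓ∈C) α⊨ℓ = v , inj₂ (ℓ∈C , α⊨ℓ)

satClause⇒lit : satClause α C → ∃ λ ℓ → ℓ ∈ᶜ C × α ⊨ ℓ
satClause⇒lit (v , inj₁ (ℓ∈C , α⊨ℓ)) = (v , true)  , occurs ℓ∈C , α⊨ℓ
satClause⇒lit (v , inj₂ (ℓ∈C , α⊨ℓ)) = (v , false) , occurs ℓ∈C , α⊨ℓ

-- Written with the raw test on litIn so that withNeg (inp m i) (clauses φ) is definitionally Q φ i.
withNeg withoutNeg : Fin k → List (Clause k) → List (Clause k)
withNeg    x = filter (λ C → litIn x false C ≟B true)
withoutNeg x = filter (λ C → ¬? (litIn x false C ≟B true))

∈-withNeg⁺ : ∀ {x} → C ∈ cs → (x , false) ∈ᶜ C → C ∈ withNeg x cs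
∈-withNeg⁺ C∈ (occurs ¬x∈C) = ∈-filter⁺ _ C∈ ¬x∈C

∈-withNeg⁻ : ∀ {x} → C ∈ withNeg x cs → C ∈ cs × (x , false) ∈ᶜ C
∈-withNeg⁻ {cs = cs} C∈ with ∈-filter⁻ _ {xs = cs} C∈
... | C∈cs , ¬x∈C = C∈cs , occurs ¬x∈C

∈-withoutNeg⁺ : ∀ {x} → C ∈ cs → ¬ (x , false) ∈ᶜ C → C ∈ withoutNeg x cs
∈-withoutNeg⁺ C∈ ¬x∉C = ∈-filter⁺ _ C∈ (¬x∉C ∘ occurs)

∈-withoutNeg⁻ : ∀ {x} → C ∈ withoutNeg x cs → C ∈ cs × ¬ (x , false) ∈ᶜ C
∈-withoutNeg⁻ {cs = cs} C∈ with ∈-filter⁻ _ {xs = cs} C∈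
... | C∈cs , ¬x∉C = C∈cs , ¬x∉C ∘ litIn≡true

∈-by : ∀ {A : Set} {x : A} {xs ys} → xs ≡ ys → x ∈ xs → x ∈ ys
∈-by eq = subst (_ ∈_) eq

∈-pair : ∀ {A : Set} {x y z : A} → x ∈ y ∷ z ∷ [] → x ≡ y ⊎ x ≡ z
∈-pair (here x≡y)         = inj₁ x≡y
∈-pair (there (here x≡z)) = inj₂ x≡z

length-partition : ∀ {A : Set} {P : A → Set} (P? : ∀ a → Dec (P a)) (xs : List A) →
                   length (filter (¬? ∘ P?) xs) + length (filter P? xs) ≡ length xs
length-partition P? [] = refl
length-partition P? (x ∷ xs) with does (P? x)
... | true  = trans (+-suc _ _) (cong suc (length-partition P? xs))
... | false = cong suc (length-partition P? xs)

remove : Lit k → Clause k → Clause k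
remove (v , b) = removeLit v b

litIn-remove-≢ : ∀ (C : Clause k) {v b w c} → (w , c) ≢ (v , b) →
                 litIn w c (removeLit v b C) ≡ litIn w c C
litIn-remove-≢ (p , q) {b = true}  {c = true}  ne = lookup∘update′ (ne ∘ cong (_, true)) p false
litIn-remove-≢ (p , q) {b = true}  {c = false} ne = refl
litIn-remove-≢ (p , q) {b = false} {c = true}  ne = refl
litIn-remove-≢ (p , q) {b = false} {c = false} ne = lookup∘update′ (ne ∘ cong (_, false)) q false

∉-remove : ∀ (C : Clause k) ℓ → ¬ ℓ ∈ᶜ remove ℓ C
∉-remove (p , q) (v , true)  (occurs ℓ∈) = not-¬ ℓ∈ (lookup∘update v p false)
∉-remove (p , q) (v , false) (occurs ℓ∈) = not-¬ ℓ∈ (lookup∘update v q false)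

∈-remove⁺ : ∀ {ℓ ℓ′} → ℓ′ ∈ᶜ C → ℓ′ ≢ ℓ → ℓ′ ∈ᶜ remove ℓ C
∈-remove⁺ {C = C} (occurs ℓ′∈C) ℓ′≢ℓ = occurs (trans (litIn-remove-≢ C ℓ′≢ℓ) ℓ′∈C)

∈-remove⁻ : ∀ {ℓ ℓ′} → ℓ′ ∈ᶜ remove ℓ C → ℓ′ ∈ᶜ C
∈-remove⁻ {C = C} {ℓ} {ℓ′} ℓ′∈ with ℓ′ ≟ˡ ℓ
... | yes refl  = contradiction ℓ′∈ (∉-remove C ℓ)
... | no  ℓ′≢ℓ = occurs (trans (sym (litIn-remove-≢ C ℓ′≢ℓ)) (litIn≡true ℓ′∈))

satClause-remove⁺ : ∀ ℓ C → satClause α C → ¬ α ⊨ ℓ → satClause α (remove ℓ C)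
satClause-remove⁺ ℓ C s α⊭ℓ with satClause⇒lit {C = C} s
... | ℓ′ , ℓ′∈ , α⊨ℓ′ = lit⇒satClause (∈-remove⁺ {ℓ = ℓ} ℓ′∈ (λ { refl → α⊭ℓ α⊨ℓ′ })) α⊨ℓ′

satClause-remove⁻ : ∀ ℓ C → satClause α (remove ℓ C) → satClause α C
satClause-remove⁻ ℓ C s with satClause⇒lit {C = remove ℓ C} s
... | _ , ℓ′∈ , α⊨ℓ′ = lit⇒satClause (∈-remove⁻ ℓ′∈) α⊨ℓ′

ones-update : ∀ (p : Vec Bool k) v → lookup p v ≡ true → ones p ≡ suc (ones (p [ v ]≔ false))
ones-update (true  Vec.∷ p) Fin.zero    _ = refl
ones-update (true  Vec.∷ p) (Fin.suc v) h = cong suc (ones-update p v h)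
ones-update (false Vec.∷ p) (Fin.suc v) h = ones-update p v h

ones-none : ∀ (p : Vec Bool k) → (∀ v → lookup p v ≢ true) → ones p ≡ 0
ones-none Vec.[]          _ = refl
ones-none (true  Vec.∷ p) h = contradiction refl (h Fin.zero)
ones-none (false Vec.∷ p) h = ones-none p (h ∘ Fin.suc)

clauseSize-remove : ∀ {ℓ} → ℓ ∈ᶜ C → clauseSize C ≡ suc (clauseSize (remove ℓ C))
clauseSize-remove {C = p , q} {v , true}  (occurs h) = cong (_+ ones q) (ones-update p v h)
clauseSize-remove {C = p , q} {v , false} (occurs h) =
  trans (cong (ones p +_) (ones-update q v h)) (+-suc _ _)

clauseSize-empty : (∀ ℓ → ¬ ℓ ∈ᶜ C) → clauseSize C ≡ 0
clauseSize-empty {C = p , q} h =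
  cong₂ _+_ (ones-none p (λ v → h (v , true) ∘ occurs)) (ones-none q (λ v → h (v , false) ∘ occurs))

record _≐_∨_ (C : Clause k) (ℓ₁ ℓ₂ : Lit k) : Set where
  field
    ∈₁   : ℓ₁ ∈ᶜ C
    ∈₂   : ℓ₂ ∈ᶜ C
    only : ∀ {ℓ} → ℓ ∈ᶜ C → ℓ ≡ ℓ₁ ⊎ ℓ ≡ ℓ₂

  clauseSize≡2 : ℓ₁ ≢ ℓ₂ → clauseSize C ≡ 2
  clauseSize≡2 ℓ₁≢ℓ₂ = begin
    clauseSize C                          ≡⟨ clauseSize-remove ∈₁ ⟩
    suc (clauseSize (remove ℓ₁ C))        ≡⟨ cong suc (clauseSize-remove (∈-remove⁺ ∈₂ (ℓ₁≢ℓ₂ ∘ sym))) ⟩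
    2 + clauseSize (remove ℓ₂ (remove ℓ₁ C)) ≡⟨ cong (2 +_) (clauseSize-empty nothing-left) ⟩
    2                                     ∎
    where
    open ≡-Reasoning
    nothing-left : ∀ ℓ → ¬ ℓ ∈ᶜ remove ℓ₂ (remove ℓ₁ C)
    nothing-left ℓ ℓ∈ with only (∈-remove⁻ (∈-remove⁻ ℓ∈))
    ... | inj₁ refl = ∉-remove C ℓ (∈-remove⁻ ℓ∈)
    ... | inj₂ refl = ∉-remove (remove ℓ₁ C) ℓ ℓ∈

  forced : satClause α C → ¬ α ⊨ ℓ₁ → α ⊨ ℓ₂
  forced s α⊭ℓ₁ with satClause⇒lit s
  ... | ℓ , ℓ∈ , α⊨ℓ with only ℓ∈
  ...   | inj₁ refl = contradiction α⊨ℓ α⊭ℓ₁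
  ...   | inj₂ refl = α⊨ℓ

≐∨-remove : ∀ {ℓ₁ ℓ₂ ℓ} → C ≐ ℓ₁ ∨ ℓ₂ → ℓ₁ ≢ ℓ → ℓ₂ ≢ ℓ → remove ℓ C ≐ ℓ₁ ∨ ℓ₂
≐∨-remove C≐ ℓ₁≢ℓ ℓ₂≢ℓ = record
  { ∈₁   = ∈-remove⁺ (_≐_∨_.∈₁ C≐) ℓ₁≢ℓ
  ; ∈₂   = ∈-remove⁺ (_≐_∨_.∈₂ C≐) ℓ₂≢ℓ
  ; only = _≐_∨_.only C≐ ∘ ∈-remove⁻
  }

_[_]≔ᵃ_ : Assignment k → Fin k → Bool → Assignment k
α [ x ]≔ᵃ b = VecF.updateAt α x (const b)

⊨-update : ∀ ℓ {x b} → α ⊨ ℓ → ℓ ≢ (x , not b) → α [ x ]≔ᵃ b ⊨ ℓ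
⊨-update {α = α} (v , d) {x} {b} α⊨ℓ ℓ≢ with v ≟F x
... | yes refl = trans (updateAt-updates v α)
                   (sym (trans (¬-not (ℓ≢ ∘ cong (v ,_))) (not-involutive b)))
... | no  v≢x  = trans (updateAt-minimal v x α v≢x) α⊨ℓ

satClause-update : ∀ {x b} → satClause α C → ¬ (x , not b) ∈ᶜ C → satClause (α [ x ]≔ᵃ b) C
satClause-update {C = C} s x∉C with satClause⇒lit {C = C} s
... | ℓ , ℓ∈ , α⊨ℓ = lit⇒satClause ℓ∈ (⊨-update ℓ α⊨ℓ (λ { refl → x∉C ℓ∈ }))

-- Encodings on an arbitrary labelling of the inputs

IsGPEOn : (Fin n → Fin k) → List (Clause k) → Set
IsGPEOn {n} {k} ι cs =
  (∀ (i : Fin n) → ∃ λ (α : Assignment k) → sat α cs × α (ι i) ≡ true)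
  × (∀ (i j : Fin n) → i ≢ j → ∀ (α : Assignment k) → sat α cs →
       α (ι i) ≡ false ⊎ α (ι j) ≡ false)

PrimeOn : (Fin n → Fin k) → List (Clause k) → Set
PrimeOn {n} {k} ι cs =
  ∀ (c : Fin (length cs)) (v : Fin k) (b : Bool) →
    litIn v b (List.lookup cs c) ≡ true → ¬ IsGPEOn ι (List.updateAt cs c (removeLit v b))

All-updateAt⁺ : ∀ {A : Set} {P : A → Set} {x xs} {f : A → A} →
                All P xs → (x∈ : x ∈ xs) → P (f x) → All P (List.updateAt xs (index x∈) f)
All-updateAt⁺ (_  ∷ pxs) (here refl) pfx = pfx ∷ pxs
All-updateAt⁺ (px ∷ pxs) (there x∈)  pfx = px ∷ All-updateAt⁺ pxs x∈ pfx

All-updateAt⁻ : ∀ {A : Set} {P : A → Set} {f : A → A} (xs : List A) c →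
                (∀ {x} → P (f x) → P x) → All P (List.updateAt xs c f) → All P xs
All-updateAt⁻ (x ∷ xs) Fin.zero    h (pfx ∷ pxs) = h pfx ∷ pxs
All-updateAt⁻ (x ∷ xs) (Fin.suc c) h (px ∷ pxs)  = px ∷ All-updateAt⁻ xs c h pxs

record Binary (x : Fin k) (C : Clause k) : Set where
  field
    partner    : Lit k
    partner≢¬x : partner ≢ (x , false)
    isPair     : C ≐ (x , false) ∨ partner
  open _≐_∨_ isPair public

module GPEOn {ι : Fin n → Fin k} {cs : List (Clause k)} (g : IsGPEOn ι cs) where

  model : Fin n → Assignment k
  model i = proj₁ (proj₁ g i)

  model-sat : ∀ i → sat (model i) cs
  model-sat i = proj₁ (proj₂ (proj₁ g i))

  model-input : ∀ i → model i (ι i) ≡ true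
  model-input i = proj₂ (proj₂ (proj₁ g i))

  atMostOne : ∀ {α i j} → sat α cs → α (ι i) ≡ true → i ≢ j → α (ι j) ≡ false
  atMostOne {α} {i} {j} s αi i≢j with proj₂ g i j i≢j α s
  ... | inj₁ αi≡false = ⊥-elim (not-¬ αi αi≡false)
  ... | inj₂ αj≡false = αj≡false

  model-other : ∀ {i j} → i ≢ j → model i (ι j) ≡ false
  model-other i≢j = atMostOne (model-sat _) (model-input _) i≢j

  -- Raising x_j to true can only break clauses through ¬x_j.
  unraisable : Injective _≡_ _≡_ ι → ∀ {α l j} → sat α cs → α (ι l) ≡ true → l ≢ j →
               ¬ All (satClause (α [ ι j ]≔ᵃ true)) (withNeg (ι j) cs)
  unraisable inj {α} {l} {j} s αl l≢j Q-sat =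
    not-¬ (updateAt-updates (ι j) α) raised-j≡false
    where
    raised-sat : sat (α [ ι j ]≔ᵃ true) cs
    raised-sat = All.tabulate λ {C} C∈ → case (ι j , false) ∈ᶜ? C of λ
      { (yes ¬x∈C) → All.lookup Q-sat (∈-withNeg⁺ C∈ ¬x∈C)
      ; (no  ¬x∉C) → satClause-update (All.lookup s C∈) ¬x∉C }
    raised-j≡false : (α [ ι j ]≔ᵃ true) (ι j) ≡ false
    raised-j≡false = atMostOne raised-sat (trans (updateAt-minimal (ι l) (ι j) α (l≢j ∘ inj)) αl) l≢j

  shrink-isGPE : ∀ {C i ℓ} (C∈ : C ∈ cs) → (ι i , false) ∈ᶜ C → ℓ ≢ (ι i , false) →
                 satClause (model i) (remove ℓ C) → IsGPEOn ι (List.updateAt cs (index C∈) (remove ℓ))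
  shrink-isGPE {C} {i} {ℓ} C∈ ¬x∈C ℓ≢¬x sat-i =
    (λ j → model j , models-sat j , model-input j) ,
    (λ j j′ j≢j′ α s → proj₂ g j j′ j≢j′ α (All-updateAt⁻ cs (index C∈) (satClause-remove⁻ ℓ _) s))
    where
    models-sat : ∀ j → sat (model j) (List.updateAt cs (index C∈) (remove ℓ))
    models-sat j with j ≟F i
    ... | yes refl = All-updateAt⁺ (model-sat j) C∈ sat-i
    ... | no  j≢i  = All-updateAt⁺ (model-sat j) C∈
                       (lit⇒satClause (∈-remove⁺ ¬x∈C (ℓ≢¬x ∘ sym)) (model-other j≢i))

  -- Primality leaves, next to ¬x_i, only the literal through which model i satisfies the clause.
  binary : PrimeOn ι cs → ∀ {C i} → C ∈ cs → (ι i , false) ∈ᶜ C → Binary (ι i) C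
  binary pr {C} {i} C∈ ¬x∈C = record
    { partner    = ℓ₀
    ; partner≢¬x = ℓ₀≢¬x
    ; isPair     = record { ∈₁ = ¬x∈C ; ∈₂ = ℓ₀∈C ; only = only }
    }
    where
    witness = satClause⇒lit (All.lookup (model-sat i) C∈)
    ℓ₀ = proj₁ witness
    ℓ₀∈C = proj₁ (proj₂ witness)
    model⊨ℓ₀ = proj₂ (proj₂ witness)
    ℓ₀≢¬x : ℓ₀ ≢ (ι i , false)
    ℓ₀≢¬x ℓ₀≡¬x = not-¬ (model-input i) (subst (model i ⊨_) ℓ₀≡¬x model⊨ℓ₀)
    only : ∀ {ℓ} → ℓ ∈ᶜ C → ℓ ≡ (ι i , false) ⊎ ℓ ≡ ℓ₀
    only {ℓ} ℓ∈C with ℓ ≟ˡ (ι i , false) | ℓ ≟ˡ ℓ₀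
    ... | yes ℓ≡¬x | _        = inj₁ ℓ≡¬x
    ... | no  _    | yes ℓ≡ℓ₀ = inj₂ ℓ≡ℓ₀
    ... | no  ℓ≢¬x | no  ℓ≢ℓ₀ =
      contradiction
        (shrink-isGPE C∈ ¬x∈C ℓ≢¬x (lit⇒satClause (∈-remove⁺ ℓ₀∈C (ℓ≢ℓ₀ ∘ sym)) model⊨ℓ₀))
        (pr (index C∈) (proj₁ ℓ) (proj₂ ℓ) (litIn≡true (subst (ℓ ∈ᶜ_) (lookup-index C∈) ℓ∈C)))

  Auxiliary : Lit k → Set
  Auxiliary ℓ = ∀ i → proj₁ ℓ ≢ ι i

  data Kind (j : Fin n) (ℓ : Lit k) : Set where
    tautology : ℓ ≡ (ι j , true) → Kind j ℓ
    negation  : ∀ i → i ≢ j → ℓ ≡ (ι i , false) → Kind j ℓ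
    auxiliary : Auxiliary ℓ → Kind j ℓ

  -- A positive partner x_i with i ≠ j is impossible, since it holds in model j.
  kind : ∀ {j C} → C ∈ cs → (B : Binary (ι j) C) → Kind j (Binary.partner B)
  kind {j} C∈ B with Binary.partner B in partner≡ | any? (λ i → proj₁ (Binary.partner B) ≟F ι i)
  ... | ℓ     | no ¬input = auxiliary λ i e → ¬input (i , e)
  ... | v , b | yes (i , v≡) with i ≟F j | b
  ...   | yes refl | true  = tautology (cong (_, true) v≡)
  ...   | yes refl | false = contradiction (trans partner≡ (cong (_, false) v≡)) (Binary.partner≢¬x B)
  ...   | no  i≢j  | false = negation i i≢j (cong (_, false) v≡)
  ...   | no  i≢j  | true  = ⊥-elim (not-¬ forced-true (model-other (i≢j ∘ sym)))
    where
    forced-true : model j (ι i) ≡ true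
    forced-true = trans (cong (model j) (sym v≡))
      (subst (model j ⊨_) partner≡
        (Binary.forced B (All.lookup (model-sat j) C∈) (not-¬ (model-input j))))

-- Transformations of encodings

Preimage : (Lit k → Lit k′) → Clause k → Lit k′ → Set
Preimage f C ℓ′ = ∃ λ ℓ → ℓ ∈ᶜ C × f ℓ ≡ ℓ′

preimage? : ∀ (f : Lit k → Lit k′) C ℓ′ → Dec (Preimage f C ℓ′)
preimage? f C ℓ′ = map′ from-variable to-variable (any? λ v → P? (v , true) ⊎-dec P? (v , false))
  where
  P : Lit _ → Set
  P ℓ = ℓ ∈ᶜ C × f ℓ ≡ ℓ′
  P? : ∀ ℓ → Dec (P ℓ)
  P? ℓ = (ℓ ∈ᶜ? C) ×-dec (f ℓ ≟ˡ ℓ′)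
  from-variable : (∃ λ v → P (v , true) ⊎ P (v , false)) → Preimage f C ℓ′
  from-variable (v , inj₁ p) = (v , true) , p
  from-variable (v , inj₂ p) = (v , false) , p
  to-variable : Preimage f C ℓ′ → ∃ λ v → P (v , true) ⊎ P (v , false)
  to-variable ((v , true) , p)  = v , inj₁ p
  to-variable ((v , false) , p) = v , inj₂ p

dec-witness : ∀ {A : Set} (a? : Dec A) → does a? ≡ true → A
dec-witness (yes a) _ = a

image : (Lit k → Lit k′) → Clause k → Clause k′
image f C = tabulate (λ w → does (preimage? f C (w , true)))
          , tabulate (λ w → does (preimage? f C (w , false)))

litIn-image : ∀ (f : Lit k → Lit k′) C ℓ′ →
              litIn (proj₁ ℓ′) (proj₂ ℓ′) (image f C) ≡ does (preimage? f C ℓ′)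
litIn-image f C (w , true)  = lookup∘tabulate _ w
litIn-image f C (w , false) = lookup∘tabulate _ w

∈-image⁺ : ∀ (f : Lit k → Lit k′) {ℓ} → ℓ ∈ᶜ C → f ℓ ∈ᶜ image f C
∈-image⁺ {C = C} f {ℓ} ℓ∈C =
  occurs (trans (litIn-image f C (f ℓ)) (dec-true (preimage? f C (f ℓ)) (ℓ , ℓ∈C , refl)))

∈-image⁻ : ∀ (f : Lit k → Lit k′) {ℓ′} → ℓ′ ∈ᶜ image f C → Preimage f C ℓ′
∈-image⁻ {C = C} f {ℓ′} (occurs ℓ′∈) =
  dec-witness (preimage? f C ℓ′) (trans (sym (litIn-image f C ℓ′)) ℓ′∈)

satClause-image : ∀ (f : Lit k → Lit k′) {α β} C → (∀ ℓ → β ⊨ ℓ → α ⊨ f ℓ) →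
                  satClause β C → satClause α (image f C)
satClause-image f C h s with satClause⇒lit {C = C} s
... | ℓ , ℓ∈ , β⊨ℓ = lit⇒satClause (∈-image⁺ f ℓ∈) (h ℓ β⊨ℓ)

satClause-image⁻ : ∀ (f : Lit k → Lit k′) {α β} C → (∀ ℓ → α ⊨ f ℓ → β ⊨ ℓ) →
                   satClause α (image f C) → satClause β C
satClause-image⁻ f C h s with satClause⇒lit {C = image f C} s
... | ℓ′ , ℓ′∈ , α⊨ℓ′ with ∈-image⁻ f ℓ′∈
...   | ℓ , ℓ∈ , refl = lit⇒satClause ℓ∈ (h ℓ α⊨ℓ′)

relabel : Permutation k k′ → Clause k → Clause k′
relabel π = image (map₁ (π ⟨$⟩ʳ_))

IsGPEOn-relabel : ∀ {ι : Fin n → Fin k} {ι′ : Fin n → Fin k′} (π : Permutation k k′) →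
                  (∀ i → π ⟨$⟩ʳ ι i ≡ ι′ i) → IsGPEOn ι cs → IsGPEOn ι′ (map (relabel π) cs)
IsGPEOn-relabel {cs = cs} {ι} {ι′} π πι (models , atMostOne) = models′ , atMostOne′
  where
  models′ : ∀ i → ∃ λ α → sat α (map (relabel π) cs) × α (ι′ i) ≡ true
  models′ i with models i
  ... | α , s , αi =
    α ∘ (π ⟨$⟩ˡ_) ,
    map⁺ (All.map (λ {C} → satClause-image _ C (λ _ α⊨ℓ → trans (cong α (inverseˡ π)) α⊨ℓ)) s) ,
    trans (cong (α ∘ (π ⟨$⟩ˡ_)) (sym (πι i))) (trans (cong α (inverseˡ π)) αi)
  atMostOne′ : ∀ i j → i ≢ j → ∀ β → sat β (map (relabel π) cs) →
               β (ι′ i) ≡ false ⊎ β (ι′ j) ≡ false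
  atMostOne′ i j i≢j β s =
    ⊎-map (subst (λ v → β v ≡ false) (πι i)) (subst (λ v → β v ≡ false) (πι j))
      (atMostOne i j i≢j (β ∘ (π ⟨$⟩ʳ_))
        (All.map (λ {C} → satClause-image⁻ _ C (λ _ β⊨ → β⊨)) (map⁻ s)))

_≟ᶜ_ : DecidableEquality (Clause k)
_≟ᶜ_ = ×-≡-dec (≡-dec _≟B_) (≡-dec _≟B_)

toCNF : ∀ {n} m (cs : List (Clause (n + m))) → IsGPEOn (inp m) cs →
        Σ (CNF n) λ ψ → GPE ψ × size ψ ≤ length cs
toCNF m cs (models , atMostOne) =
  record { m = m ; clauses = deduplicate _≟ᶜ_ cs ; distinct = deduplicate-! _≟ᶜ_ cs } ,
  ((λ i → let (α , s , αi) = models i in α , deduplicate⁺ _≟ᶜ_ s , αi) ,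
   (λ i j i≢j α s → atMostOne i j i≢j α (deduplicate⁻ _≟ᶜ_ (λ { refl p → p }) cs s))) ,
  length-deduplicate _≟ᶜ_ cs

punchIn-↑ˡ : ∀ {n} m (i : Fin (suc n)) (j : Fin n) → punchIn (i ↑ˡ m) (j ↑ˡ m) ≡ punchIn i j ↑ˡ m
punchIn-↑ˡ m Fin.zero    j           = refl
punchIn-↑ˡ m (Fin.suc i) Fin.zero    = refl
punchIn-↑ˡ m (Fin.suc i) (Fin.suc j) = cong Fin.suc (punchIn-↑ˡ m i j)

punchIn-fromℕ : ∀ n (j : Fin n) → punchIn (fromℕ n) j ≡ inject₁ j
punchIn-fromℕ (suc n) Fin.zero    = refl
punchIn-fromℕ (suc n) (Fin.suc j) = cong Fin.suc (punchIn-fromℕ n j)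

-- x_i becomes the first auxiliary variable, the inputs after it move down by one.
vacate : ∀ {n} m (i : Fin (suc n)) → Permutation (suc n + m) (n + suc m)
vacate {n} m i = Perm.insert (inp m i) (fromℕ n ↑ˡ m) Perm.id ∘ₚ Perm.cast-id (sym (+-suc n m))

vacate-punchIn : ∀ {n} m (i : Fin (suc n)) j → vacate m i ⟨$⟩ʳ inp m (punchIn i j) ≡ inp (suc m) j
vacate-punchIn {n} m i j = toℕ-injective (begin
  toℕ (cast _ (insertion ⟨$⟩ʳ inp m (punchIn i j)))
    ≡⟨ toℕ-cast _ _ ⟩
  toℕ (insertion ⟨$⟩ʳ inp m (punchIn i j))
    ≡⟨ cong (toℕ ∘ (insertion ⟨$⟩ʳ_)) (sym (punchIn-↑ˡ m i j)) ⟩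
  toℕ (insertion ⟨$⟩ʳ punchIn (inp m i) (inp m j))
    ≡⟨ cong toℕ (Perm.insert-punchIn (inp m i) _ Perm.id (inp m j)) ⟩
  toℕ (punchIn (fromℕ n ↑ˡ m) (j ↑ˡ m))
    ≡⟨ cong toℕ (punchIn-↑ˡ m (fromℕ n) j) ⟩
  toℕ (punchIn (fromℕ n) j ↑ˡ m)
    ≡⟨ toℕ-↑ˡ _ m ⟩
  toℕ (punchIn (fromℕ n) j)
    ≡⟨ cong toℕ (punchIn-fromℕ n j) ⟩
  toℕ (inject₁ j)
    ≡⟨ toℕ-inject₁ j ⟩
  toℕ j
    ≡⟨ toℕ-↑ˡ j (suc m) ⟨
  toℕ (j ↑ˡ suc m)
    ∎)
  where
  open ≡-Reasoning
  insertion = Perm.insert (inp m i) (fromℕ n ↑ˡ m) Perm.id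

dropInput : ∀ {n m} (i : Fin (suc n)) {cs : List (Clause (suc n + m))} →
            IsGPEOn (inp m ∘ punchIn i) cs → Σ (CNF n) λ ψ → GPE ψ × size ψ ≤ length cs
dropInput {m = m} i {cs} g
  with toCNF (suc m) (map (relabel (vacate m i)) cs) (IsGPEOn-relabel (vacate m i) (vacate-punchIn m i) g)
... | ψ , gψ , size≤ = ψ , gψ , ≤-trans size≤ (≤-reflexive (length-map _ cs))

module Elimination {ι : Fin (suc n) → Fin k} {cs : List (Clause k)} (g : IsGPEOn ι cs)
                   (inj : Injective _≡_ _≡_ ι) (i : Fin (suc n)) where
  open GPEOn g

  private
    x : Fin k
    x = ι i

  reduced : List (Clause k)
  reduced = map (removeLit x true) (withoutNeg x cs)

  length-reduced : length reduced + length (withNeg x cs) ≡ length cs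
  length-reduced = trans (cong (_+ length (withNeg x cs)) (length-map _ (withoutNeg x cs)))
                         (length-partition (λ C → litIn x false C ≟B true) cs)

  sat-reduced : sat α cs → α x ≡ false → sat α reduced
  sat-reduced s αx = map⁺ (All.tabulate λ {C} C∈ →
    satClause-remove⁺ (x , true) C (All.lookup s (proj₁ (∈-withoutNeg⁻ C∈)))
      (λ αx≡true → not-¬ αx≡true αx))

  lowered-sat : sat β reduced → sat (β [ x ]≔ᵃ false) cs
  lowered-sat {β = β} s = All.tabulate λ {C} C∈ → case (x , false) ∈ᶜ? C of λ
    { (yes ¬x∈C) → lit⇒satClause ¬x∈C (updateAt-updates x β)
    ; (no  ¬x∉C) → satClause-remove⁻ (x , true) C
        (satClause-update {C = remove (x , true) C}
          (All.lookup (map⁻ s) (∈-withoutNeg⁺ C∈ ¬x∉C)) (∉-remove C (x , true)))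
    }

  isGPE : IsGPEOn (ι ∘ punchIn i) reduced
  isGPE =
    (λ j → model (punchIn i j) ,
           sat-reduced (model-sat _) (model-other (punchInᵢ≢i i j)) ,
           model-input _) ,
    (λ j j′ j≢j′ β s →
      ⊎-map (unlowered j) (unlowered j′)
        (proj₂ g (punchIn i j) (punchIn i j′) (j≢j′ ∘ punchIn-injective i j j′) _ (lowered-sat s)))
    where
    unlowered : ∀ {β} j → (β [ x ]≔ᵃ false) (ι (punchIn i j)) ≡ false → β (ι (punchIn i j)) ≡ false
    unlowered {β} j = trans (sym (updateAt-minimal _ x β (punchInᵢ≢i i j ∘ inj)))

xor-cancelˡ : ∀ s d → s xor (s xor d) ≡ d
xor-cancelˡ false d = refl
xor-cancelˡ true  d = not-involutive d

not-xor-true : ∀ b → not b xor true ≡ b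
not-xor-true false = refl
not-xor-true true  = refl

-- y^d becomes x^(not b xor d); in particular y^b becomes x.
rename : Fin k → Bool → Fin k → Lit k → Lit k
rename y b x (v , d) with v ≟F y
... | yes _ = x , not b xor d
... | no  _ = v , d

⊨-rename : ∀ {y b x} ℓ → α y ≡ not b xor α x → α ⊨ ℓ → α ⊨ rename y b x ℓ
⊨-rename {α = α} {y} {b} {x} (v , d) αy α⊨ℓ with v ≟F y
... | yes refl = begin
  α x                         ≡⟨ xor-cancelˡ (not b) (α x) ⟨
  not b xor (not b xor α x)   ≡⟨ cong (not b xor_) (trans (sym αy) α⊨ℓ) ⟩
  not b xor d                 ∎
  where open ≡-Reasoning
... | no  _ = α⊨ℓ

⊨-rename⁻ : ∀ {y b x} ℓ → β ⊨ rename y b x ℓ → β [ y ]≔ᵃ (not b xor β x) ⊨ ℓ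
⊨-rename⁻ {β = β} {y} {b} {x} (v , d) β⊨ with v ≟F y
... | yes refl = trans (updateAt-updates v β) (trans (cong (not b xor_) β⊨) (xor-cancelˡ (not b) d))
... | no  v≢y  = trans (updateAt-minimal v y β v≢y) β⊨

-- When every clause of Q_j is ¬x_j ∨ y^b with y auxiliary, y^b agrees with x_j in every model,
-- so y can be replaced by x_j and the clauses of Q_j, now tautologies, dropped.
module Substitution {ι : Fin n → Fin k} {cs : List (Clause k)} (g : IsGPEOn ι cs)
                    (inj : Injective _≡_ _≡_ ι)
                    (j : Fin n) (y : Fin k) (b : Bool) (y-aux : ∀ i → y ≢ ι i)
                    (pairs : ∀ {C} → C ∈ cs → (ι j , false) ∈ᶜ C → C ≐ (ι j , false) ∨ (y , b))
                    {C₀ : Clause k} (C₀∈ : C₀ ∈ cs) (¬x∈C₀ : (ι j , false) ∈ᶜ C₀) where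
  open GPEOn g

  private
    x : Fin k
    x = ι j

  substituted : List (Clause k)
  substituted = map (image (rename y b x)) (withoutNeg x cs)

  length-substituted : length substituted < length cs
  length-substituted = begin-strict
    length substituted        ≡⟨ length-map _ (withoutNeg x cs) ⟩
    length (withoutNeg x cs)  <⟨ filter-notAll _ cs (Any.map (λ { refl ¬x∉C₀ → ¬x∉C₀ ¬x∈C₀′ }) C₀∈) ⟩
    length cs                 ∎
    where
    open ≤-Reasoning
    ¬x∈C₀′ = litIn≡true ¬x∈C₀

  -- In any model of another input, y^b must fail: otherwise x_j could be raised.
  model-y : ∀ i → model i y ≡ not b xor model i x
  model-y i with i ≟F j
  ... | yes refl =
    trans (_≐_∨_.forced (pairs C₀∈ ¬x∈C₀) (All.lookup (model-sat i) C₀∈) (not-¬ (model-input i)))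
          (sym (trans (cong (not b xor_) (model-input i)) (not-xor-true b)))
  ... | no  i≢j =
    trans (¬-not y≢b) (sym (trans (cong (not b xor_) (model-other i≢j)) (xor-identityʳ (not b))))
    where
    y≢b : model i y ≢ b
    y≢b y≡b = unraisable inj (model-sat i) (model-input i) i≢j (All.tabulate λ C∈Q →
      let (C∈ , ¬x∈C) = ∈-withNeg⁻ C∈Q in
      lit⇒satClause (_≐_∨_.∈₂ (pairs C∈ ¬x∈C)) (trans (updateAt-minimal y x (model i) (y-aux j)) y≡b))

  sat-substituted : sat α cs → α y ≡ not b xor α x → sat α substituted
  sat-substituted s αy = map⁺ (All.tabulate λ {C} C∈ →
    satClause-image (rename y b x) C (λ ℓ → ⊨-rename ℓ αy) (All.lookup s (proj₁ (∈-withoutNeg⁻ C∈))))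

  restored-sat : sat β substituted → sat (β [ y ]≔ᵃ (not b xor β x)) cs
  restored-sat {β = β} s = All.tabulate λ {C} C∈ → case (x , false) ∈ᶜ? C of λ
    { (yes ¬x∈C) → pair-sat (pairs C∈ ¬x∈C)
    ; (no  ¬x∉C) → satClause-image⁻ (rename y b x) C (λ ℓ → ⊨-rename⁻ ℓ)
                       (All.lookup (map⁻ s) (∈-withoutNeg⁺ C∈ ¬x∉C))
    }
    where
    pair-sat : ∀ {C} → C ≐ (x , false) ∨ (y , b) → satClause (β [ y ]≔ᵃ (not b xor β x)) C
    pair-sat C≐ with β x in βx
    ... | false = lit⇒satClause (_≐_∨_.∈₁ C≐) (trans (updateAt-minimal x y β (y-aux j ∘ sym)) βx)
    ... | true  = lit⇒satClause (_≐_∨_.∈₂ C≐)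
                    (trans (updateAt-updates y β) (not-xor-true b))

  isGPE : IsGPEOn ι substituted
  isGPE =
    (λ i → model i , sat-substituted (model-sat i) (model-y i) , model-input i) ,
    (λ i i′ i≢i′ β s → ⊎-map (unrestored i) (unrestored i′) (proj₂ g i i′ i≢i′ _ (restored-sat s)))
    where
    unrestored : ∀ {β} i → (β [ y ]≔ᵃ (not b xor β x)) (ι i) ≡ false → β (ι i) ≡ false
    unrestored {β} i = trans (sym (updateAt-minimal (ι i) y β (y-aux i ∘ sym)))

module _ {n} (a b c : Fin n) where
  private
    Hit : Fin n → Set
    Hit l = l ≡ a ⊎ l ≡ b ⊎ l ≡ c

    hit? : ∀ l → Dec (Hit l)
    hit? l = (l ≟F a) ⊎-dec (l ≟F b) ⊎-dec (l ≟F c)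

    label : ∀ {l} → Hit l → Fin 3
    label (inj₁ _)        = 0F
    label (inj₂ (inj₁ _)) = 1F
    label (inj₂ (inj₂ _)) = 2F

    point : Fin 3 → Fin n
    point 0F = a
    point 1F = b
    point 2F = c

    point∘label : ∀ {l} (h : Hit l) → point (label h) ≡ l
    point∘label (inj₁ l≡a)        = sym l≡a
    point∘label (inj₂ (inj₁ l≡b)) = sym l≡b
    point∘label (inj₂ (inj₂ l≡c)) = sym l≡c

  avoid₃ : 4 ≤ n → ∃ λ l → l ≢ a × l ≢ b × l ≢ c
  avoid₃ 4≤n with ¬∀⟶∃¬ n Hit hit? all-hit⇒⊥
    where
    all-hit⇒⊥ : ¬ (∀ l → Hit l)
    all-hit⇒⊥ hit with pigeonhole 4≤n (λ l → label (hit l))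
    ... | l , l′ , l<l′ , same-label =
      <⇒≢ l<l′ (trans (sym (point∘label (hit l)))
                      (trans (cong point same-label) (point∘label (hit l′))))
  ... | l , missed = l , missed ∘ inj₁ , missed ∘ inj₂ ∘ inj₁ , missed ∘ inj₂ ∘ inj₂

-- Minimum-size prime encodings

module Minimal {n} (φ : CNF (suc n)) (gpe : GPE φ) (prime : Prime φ)
               (minimal : ∀ (ψ : CNF (suc n)) → GPE ψ → size φ ≤ size ψ) (4≤ : 4 ≤ suc n) where

  private
    K : ℕ
    K = suc n + m φ

    ι : Fin (suc n) → Fin K
    ι = inp (m φ)

    inj : Injective _≡_ _≡_ ι
    inj = ↑ˡ-injective (m φ) _ _

  open GPEOn gpe

  Reduction : Set
  Reduction = Σ (CNF n) λ ψ → GPE ψ × size ψ + 3 ≤ size φ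

  RegularClause : Fin (suc n) → Clause K → Set
  RegularClause i C =
    clauseSize C ≡ 2 × (∀ j → j ≢ i → lookup (pos C) (ι j) ≡ false × lookup (neg C) (ι j) ≡ false)

  RegularAt : Fin (suc n) → Set
  RegularAt i = length (Q φ i) ≡ 2 × All (RegularClause i) (Q φ i)

  ∈-Q⁺ : ∀ {i C} → C ∈ clauses φ → (ι i , false) ∈ᶜ C → C ∈ Q φ i
  ∈-Q⁺ = ∈-withNeg⁺

  ∈-Q⁻ : ∀ {i C} → C ∈ Q φ i → C ∈ clauses φ × (ι i , false) ∈ᶜ C
  ∈-Q⁻ = ∈-withNeg⁻ {cs = clauses φ}

  binaryQ : ∀ {i C} → C ∈ Q φ i → Binary (ι i) C
  binaryQ C∈ = binary prime (proj₁ (∈-Q⁻ C∈)) (proj₂ (∈-Q⁻ C∈))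

  partnerQ : ∀ {i C} → C ∈ Q φ i → Lit K
  partnerQ = Binary.partner ∘ binaryQ

  kindQ : ∀ {i C} (C∈ : C ∈ Q φ i) → Kind i (partnerQ C∈)
  kindQ C∈ = kind (proj₁ (∈-Q⁻ C∈)) (binaryQ C∈)

  three-or-more : ∀ {i a b c xs} → Q φ i ≡ a ∷ b ∷ c ∷ xs → 3 ≤ length (Q φ i)
  three-or-more eq = subst (λ ys → 3 ≤ length ys) (sym eq) (s≤s (s≤s (s≤s z≤n)))

  fresh : (a b c : Fin (suc n)) → ∃ λ l → l ≢ a × l ≢ b × l ≢ c
  fresh a b c = avoid₃ a b c 4≤

  raised : Fin (suc n) → Fin (suc n) → Assignment K
  raised l j = model l [ ι j ]≔ᵃ true

  unraisable-Q : ∀ {l j} → l ≢ j → ¬ All (satClause (raised l j)) (Q φ j)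
  unraisable-Q = unraisable inj (model-sat _) (model-input _)

  raised⊨¬x : ∀ {l j i} → i ≢ j → l ≢ i → raised l j ⊨ (ι i , false)
  raised⊨¬x i≢j l≢i = ⊨-update (ι _ , false) (model-other l≢i) (i≢j ∘ inj ∘ cong proj₁)

  Survives : Fin (suc n) → Clause K → Set
  Survives j C = ∃ λ k → ∀ {l} → l ≢ j → l ≢ k → satClause (raised l j) C

  survives-or-aux : ∀ {j C} (C∈ : C ∈ Q φ j) → Survives j C ⊎ Auxiliary (partnerQ C∈)
  survives-or-aux {j} {C} C∈ = from-kind (kindQ C∈)
    where
    partner∈ = Binary.∈₂ (binaryQ C∈)
    from-kind : Kind j (partnerQ C∈) → Survives j C ⊎ Auxiliary (partnerQ C∈)
    from-kind (tautology p)      = inj₁ (j , λ {l} _ _ →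
      lit⇒satClause (subst (_∈ᶜ C) p partner∈) (updateAt-updates (ι j) (model l)))
    from-kind (negation i i≢j p) = inj₁ (i , λ _ l≢i →
      lit⇒satClause (subst (_∈ᶜ C) p partner∈) (raised⊨¬x i≢j l≢i))
    from-kind (auxiliary aux)    = inj₂ aux

  eliminate-large : ∀ i → 3 ≤ length (Q φ i) → Reduction
  eliminate-large i 3≤ = proj₁ dropped , proj₁ (proj₂ dropped) , (begin
    size (proj₁ dropped) + 3            ≤⟨ +-mono-≤ (proj₂ (proj₂ dropped)) 3≤ ⟩
    length E.reduced + length (Q φ i)   ≡⟨ E.length-reduced ⟩
    size φ                              ∎)
    where
    open ≤-Reasoning
    module E = Elimination gpe inj i
    dropped = dropInput i E.isGPE

  eliminate-substitute : ∀ {i j D} → j ≢ i → length (Q φ i) ≡ 2 → (D∈ : D ∈ Q φ j) →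
                         Auxiliary (partnerQ D∈) →
                         (∀ {C} → C ∈ Q φ j → C ≡ D ⊎ (ι i , false) ∈ᶜ C) → Reduction
  eliminate-substitute {i} {D = D} j≢i |Q|≡2 D∈ aux others
    with punchOut (j≢i ∘ sym) | punchIn-punchOut (j≢i ∘ sym)
  ... | j′ | refl = proj₁ dropped , proj₁ (proj₂ dropped) , (begin
    size (proj₁ dropped) + 3          ≤⟨ +-monoˡ-≤ 3 (proj₂ (proj₂ dropped)) ⟩
    length S.substituted + 3          ≡⟨ +-suc (length S.substituted) 2 ⟩
    suc (length S.substituted) + 2    ≤⟨ +-monoˡ-≤ 2 S.length-substituted ⟩
    length E.reduced + 2              ≡⟨ cong (length E.reduced +_) |Q|≡2 ⟨
    length E.reduced + length (Q φ i) ≡⟨ E.length-reduced ⟩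
    size φ                            ∎)
    where
    open ≤-Reasoning
    module E = Elimination gpe inj i
    B = binaryQ D∈
    D∈cs = proj₁ (∈-Q⁻ D∈)
    partner≢xi : partnerQ D∈ ≢ (ι i , true)
    partner≢xi = aux i ∘ cong proj₁
    ¬xi∉D : ¬ (ι i , false) ∈ᶜ D
    ¬xi∉D ¬xi∈D with Binary.only B ¬xi∈D
    ... | inj₁ ¬xi≡¬xj  = j≢i (sym (inj (cong proj₁ ¬xi≡¬xj)))
    ... | inj₂ ¬xi≡partner = aux i (sym (cong proj₁ ¬xi≡partner))
    pairs : ∀ {C₁} → C₁ ∈ E.reduced → (ι (punchIn i j′) , false) ∈ᶜ C₁ →
            C₁ ≐ (ι (punchIn i j′) , false) ∨ partnerQ D∈
    pairs C₁∈ ¬xj∈C₁ with ∈-map⁻ (removeLit (ι i) true) C₁∈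
    ... | C , C∈ , refl with ∈-withoutNeg⁻ {cs = clauses φ} C∈
    ...   | C∈cs , ¬xi∉C with others (∈-withNeg⁺ C∈cs (∈-remove⁻ {ℓ = ι i , true} ¬xj∈C₁))
    ...     | inj₁ refl   = ≐∨-remove (Binary.isPair B) (λ ()) partner≢xi
    ...     | inj₂ ¬xi∈C = contradiction ¬xi∈C ¬xi∉C
    module S = Substitution E.isGPE (punchIn-injective i _ _ ∘ inj) j′
                 (proj₁ (partnerQ D∈)) (proj₂ (partnerQ D∈)) (aux ∘ punchIn i) pairs
                 (∈-map⁺ (removeLit (ι i) true) (∈-withoutNeg⁺ {cs = clauses φ} D∈cs ¬xi∉D))
                 (∈-remove⁺ {ℓ = ι i , true} (Binary.∈₁ B) (λ ()))
    dropped = dropInput i S.isGPE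

  Q≢[] : ∀ i → Q φ i ≢ []
  Q≢[] i Q≡[] with fresh i i i
  ... | l , l≢i , _ = unraisable-Q l≢i (subst (All _) (sym Q≡[]) [])

  Q≢[_] : ∀ {i} D → Q φ i ≢ D ∷ []
  Q≢[_] {i} D Q≡[D] = [ survivor⇒⊥ , aux⇒⊥ ]′ (survives-or-aux D∈)
    where
    D∈ : D ∈ Q φ i
    D∈ = subst (D ∈_) (sym Q≡[D]) (here refl)
    survivor⇒⊥ : Survives i D → ⊥
    survivor⇒⊥ (k , survives) with fresh i k k
    ... | l , l≢i , l≢k , _ = unraisable-Q l≢i (subst (All _) (sym Q≡[D]) (survives l≢i l≢k ∷ []))
    pairs : ∀ {C} → C ∈ clauses φ → (ι i , false) ∈ᶜ C → C ≐ (ι i , false) ∨ partnerQ D∈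
    pairs C∈ ¬xi∈C with subst (_ ∈_) Q≡[D] (∈-withNeg⁺ C∈ ¬xi∈C)
    ... | here refl = Binary.isPair (binaryQ D∈)
    aux⇒⊥ : Auxiliary (partnerQ D∈) → ⊥
    aux⇒⊥ aux = case toCNF (m φ) S.substituted S.isGPE of λ
      { (ψ , gψ , size≤) →
          <-irrefl refl (≤-<-trans (≤-trans (minimal ψ gψ) size≤) S.length-substituted) }
      where
      module S = Substitution gpe inj i (proj₁ (partnerQ D∈)) (proj₂ (partnerQ D∈)) aux pairs
                   (proj₁ (∈-Q⁻ D∈)) (proj₂ (∈-Q⁻ D∈))

  Q-pair-reduction : ∀ {i j C D} → j ≢ i → length (Q φ i) ≡ 2 → (ι i , false) ∈ᶜ C →
                     (D∈ : D ∈ Q φ j) → (∀ {C′} → C′ ∈ Q φ j → C′ ≡ C ⊎ C′ ≡ D) → Reduction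
  Q-pair-reduction {i} {j} {C} {D} j≢i |Q|≡2 ¬xi∈C D∈ covered =
    [ survivor⇒⊥ , via-aux ]′ (survives-or-aux D∈)
    where
    survivor⇒⊥ : Survives j D → Reduction
    survivor⇒⊥ (k , survives) with fresh i j k
    ... | l , l≢i , l≢j , l≢k = ⊥-elim (unraisable-Q l≢j (All.tabulate λ C′∈ → case covered C′∈ of λ
      { (inj₁ refl) → lit⇒satClause ¬xi∈C (raised⊨¬x (j≢i ∘ sym) l≢i)
      ; (inj₂ refl) → survives l≢j l≢k }))
    via-aux : Auxiliary (partnerQ D∈) → Reduction
    via-aux aux = eliminate-substitute j≢i |Q|≡2 D∈ aux λ C′∈ → case covered C′∈ of λ
      { (inj₁ refl) → inj₂ ¬xi∈C
      ; (inj₂ refl) → inj₁ refl }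

  OtherNegation : Fin (suc n) → Clause K → Set
  OtherNegation i C = ∃ λ j → j ≢ i × (ι j , false) ∈ᶜ C

  negative-pair-reduction : ∀ {i C} → length (Q φ i) ≡ 2 → C ∈ Q φ i → OtherNegation i C → Reduction
  negative-pair-reduction {i} {C} |Q|≡2 C∈Qi (j , j≢i , ¬xj∈C) = by-shape (Q φ j) refl
    where
    ¬xi∈C = proj₂ (∈-Q⁻ C∈Qi)
    C∈Qj : C ∈ Q φ j
    C∈Qj = ∈-Q⁺ (proj₁ (∈-Q⁻ C∈Qi)) ¬xj∈C
    by-shape : ∀ xs → Q φ j ≡ xs → Reduction
    by-shape []             eq = ⊥-elim (Q≢[] j eq)
    by-shape (D ∷ [])       eq = ⊥-elim (Q≢[ D ] eq)
    by-shape (D₁ ∷ D₂ ∷ []) eq with ∈-pair (∈-by eq C∈Qj)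
    ... | inj₁ refl = Q-pair-reduction j≢i |Q|≡2 ¬xi∈C (∈-by (sym eq) (there (here refl)))
                        (∈-pair ∘ ∈-by eq)
    ... | inj₂ refl = Q-pair-reduction j≢i |Q|≡2 ¬xi∈C (∈-by (sym eq) (here refl))
                        (⊎-swap ∘ ∈-pair ∘ ∈-by eq)
    by-shape (_ ∷ _ ∷ _ ∷ _) eq = eliminate-large j (three-or-more eq)

  negation-or-regular : ∀ {i C} (C∈ : C ∈ Q φ i) → OtherNegation i C ⊎ RegularClause i C
  negation-or-regular {i} {C} C∈ = from-kind (kindQ C∈)
    where
    B = binaryQ C∈
    regular : (∀ j → j ≢ i → proj₁ (partnerQ C∈) ≢ ι j) → RegularClause i C
    regular other =
      Binary.clauseSize≡2 B (Binary.partner≢¬x B ∘ sym) , λ j j≢i → absent j j≢i {true} , absent j j≢i {false}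
      where
      absent : ∀ j → j ≢ i → ∀ {b} → litIn (ι j) b C ≡ false
      absent j j≢i {b} = ¬-not λ ℓ∈C → case Binary.only B (occurs {ℓ = ι j , b} ℓ∈C) of λ
        { (inj₁ e) → j≢i (inj (cong proj₁ e))
        ; (inj₂ e) → other j j≢i (sym (cong proj₁ e)) }
    from-kind : Kind i (partnerQ C∈) → OtherNegation i C ⊎ RegularClause i C
    from-kind (tautology p)      = inj₂ (regular λ j j≢i e → j≢i (inj (trans (sym e) (cong proj₁ p))))
    from-kind (negation j j≢i p) = inj₁ (j , j≢i , subst (_∈ᶜ C) p (Binary.∈₂ B))
    from-kind (auxiliary aux)    = inj₂ (regular λ j _ → aux j)

  reduction-or-regularAt : ∀ i → Reduction ⊎ RegularAt i
  reduction-or-regularAt i = by-shape (Q φ i) refl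
    where
    by-shape : ∀ xs → Q φ i ≡ xs → Reduction ⊎ RegularAt i
    by-shape []             eq = ⊥-elim (Q≢[] i eq)
    by-shape (D ∷ [])       eq = ⊥-elim (Q≢[ D ] eq)
    by-shape (C₁ ∷ C₂ ∷ []) eq = pair (negation-or-regular C₁∈) (negation-or-regular C₂∈)
      where
      |Q|≡2 = cong length eq
      C₁∈ = ∈-by (sym eq) (here refl)
      C₂∈ = ∈-by (sym eq) (there (here refl))
      pair : OtherNegation i C₁ ⊎ RegularClause i C₁ → OtherNegation i C₂ ⊎ RegularClause i C₂ →
             Reduction ⊎ RegularAt i
      pair (inj₁ negation₁) _                = inj₁ (negative-pair-reduction |Q|≡2 C₁∈ negation₁)
      pair (inj₂ _)         (inj₁ negation₂) = inj₁ (negative-pair-reduction |Q|≡2 C₂∈ negation₂)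
      pair (inj₂ regular₁)  (inj₂ regular₂)  =
        inj₂ (|Q|≡2 , subst (All (RegularClause i)) (sym eq) (regular₁ ∷ regular₂ ∷ []))
    by-shape (_ ∷ _ ∷ _ ∷ _) eq = inj₁ (eliminate-large i (three-or-more eq))

  -- RegularForm φ unfolds to ∀ i → RegularAt i.
  reduction-or-regular : Reduction ⊎ RegularForm φ
  reduction-or-regular = sequence (SumLeft.applicative Reduction 0ℓ) reduction-or-regularAt

lemma16 : (n : ℕ) → 4 ≤ n → (φ : CNF n) → GPE φ → Prime φ →
          (∀ (ψ : CNF n) → GPE ψ → size φ ≤ size ψ) →
          (Σ (CNF n) (λ φ' → GPE φ' × RegularForm φ' × size φ' ≡ size φ))
          ⊎ (Σ (CNF (n ∸ 1)) (λ φ' → GPE φ' × size φ' + 3 ≤ size φ))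
lemma16 zero ()
lemma16 (suc n) 4≤n φ gpe prime minimal =
  [ inj₂ , (λ regular → inj₁ (φ , gpe , regular , refl)) ]′
    (Minimal.reduction-or-regular φ gpe prime minimal 4≤n)
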